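{- Let $\mathcal{S}$ be a scramble of order at least $2$ on a graph $G$, let $e\in E(G)$ be an edge such that $H=G-e$ is connected, and let $\mathcal{S}'=\mathcal{S}|_H$. Then $\|\mathcal{S}'\|\geq \|\mathcal{S}\|-1$.
   Context: Graphs are finite, with multiple edges allowed but no loops. An egg is a nonempty vertex subset inducing a connected subgraph; a scramble $\mathcal{S}$ is a collection of eggs; $h(\mathcal{S})$ is the minimum size of a vertex set meeting every egg; an egg-cut is an edge set whose deletion disconnects the graph into two components each containing an egg, and $e(\mathcal{S})$ is the minimum size of an egg-cut ($\infty$ if none); $\|\mathcal{S}\|=\min\{h(\mathcal{S}),e(\mathcal{S})\}$. For a subgraph $H$ of $G$, the restriction $\mathcal{S}|_H$ is the scramble on $H$ consisting of the sets $E\cap V(H)$ for those eggs $E\in\mathcal{S}$ such that $E\cap V(H)$ is nonempty and induces a connected subgraph of $H$. -}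

module Defs where

open import Data.Nat using (ℕ; _≤_; _∸_)
open import Data.Fin using (Fin)
open import Data.Fin.Subset using (Subset; _∈_; _∉_; _⊆_; ∣_∣; ∁; ⊤)
open import Data.Product using (Σ; _×_; _,_; ∃; ∃-syntax)
open import Data.Sum using (_⊎_)
open import Data.Unit renaming (⊤ to Unit)
open import Relation.Nullary using (¬_)
open import Relation.Binary.PropositionalEquality using (_≡_; _≢_)

-- A finite multigraph without loops: vertices Fin n, edges Fin m,
-- each edge has two distinct end vertices (parallel edges allowed).
record Graph : Set where
  field
    n     : ℕ
    m     : ℕ
    ends  : Fin m → Fin n × Fin n
    loopless : ∀ i → Data.Product.proj₁ (ends i) ≢ Data.Product.proj₂ (ends i)

open Graph public

-- An "edge set" of G: a predicate on the edge indices; a spanning subgraph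
-- of G is given by such a predicate.  The whole graph uses allEdges.
EdgeSet : Graph → Set₁
EdgeSet G = Fin (m G) → Set

allEdges : (G : Graph) → EdgeSet G
allEdges G _ = Unit

deleteEdge : (G : Graph) → Fin (m G) → EdgeSet G
deleteEdge G e i = i ≢ e

Joins : (G : Graph) → Fin (m G) → Fin (n G) → Fin (n G) → Set
Joins G i x y = ends G i ≡ (x , y) ⊎ ends G i ≡ (y , x)

data Reach (G : Graph) (A : EdgeSet G) (W : Subset (n G)) (u : Fin (n G)) : Fin (n G) → Set where
  here : u ∈ W → Reach G A W u u
  step : ∀ {x y} (i : Fin (m G)) → A i → Joins G i x y →
         Reach G A W u x → y ∈ W → Reach G A W u y

-- W induces a connected subgraph of the spanning subgraph (V, A)
-- (nonemptiness is not included here)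
InducesConnected : (G : Graph) → EdgeSet G → Subset (n G) → Set
InducesConnected G A W = ∀ u v → u ∈ W → v ∈ W → Reach G A W u v

IsConnected : (G : Graph) → EdgeSet G → Set
IsConnected G A = ∀ u v → Reach G A ⊤ u v

IsEgg : (G : Graph) → EdgeSet G → Subset (n G) → Set
IsEgg G A E = (∃[ v ] v ∈ E) × InducesConnected G A E

-- A scramble on (V, A): a collection of eggs, given as a predicate on vertex
-- subsets (a finite collection, since Subset n is finite) all of whose members are eggs.
record Scramble (G : Graph) (A : EdgeSet G) : Set₁ where
  field
    eggs  : Subset (n G) → Set
    isEgg : ∀ E → eggs E → IsEgg G A E

open Scramble public

Hits : {G : Graph} {A : EdgeSet G} → Scramble G A → Subset (n G) → Set
Hits S T = ∀ E → eggs S E → ∃[ v ] (v ∈ E × v ∈ T)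

-- C is an egg-cut of S in (V, A): C is a set of edges of A whose deletion
-- leaves exactly two components, X and its complement, each containing an egg of S.
IsEggCut : {G : Graph} {A : EdgeSet G} → Scramble G A → Subset (m G) → Set
IsEggCut {G} {A} S C =
  (∀ i → i ∈ C → A i) ×
  (∃[ X ] ( (∃[ v ] v ∈ X) × (∃[ v ] v ∉ X)
          × InducesConnected G A' X
          × InducesConnected G A' (∁ X)
          × (∀ i x y → A' i → Joins G i x y → x ∈ X → y ∉ X → Data.Empty.⊥)
          × (∃[ E ] (eggs S E × E ⊆ X))
          × (∃[ E ] (eggs S E × E ⊆ ∁ X))))
  where
    import Data.Empty
    A' : EdgeSet G
    A' i = A i × i ∉ C

-- ‖S‖ ≥ k, where ‖S‖ = min{h(S), e(S)}: every hitting set has size ≥ k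
-- (h(S) ≥ k) and every egg-cut has size ≥ k (e(S) ≥ k; vacuous if e(S) = ∞).
OrderAtLeast : {G : Graph} {A : EdgeSet G} → Scramble G A → ℕ → Set
OrderAtLeast S k =
  (∀ T → Hits S T → k ≤ ∣ T ∣) × (∀ C → IsEggCut S C → k ≤ ∣ C ∣)

-- Restriction of S to the spanning subgraph H = (V, B) of (V, A):
-- E ∩ V(H) = E, so keep exactly those eggs that induce a connected subgraph of H.
restrict : {G : Graph} {A : EdgeSet G} (S : Scramble G A) (B : EdgeSet G) → Scramble G B
restrict {G} S B = record
  { eggs  = λ E → eggs S E × InducesConnected G B E
  ; isEgg = λ E p → (Data.Product.proj₁ (isEgg S E (Data.Product.proj₁ p))) , Data.Product.proj₂ p }

-- Let a be an end of e.  An egg of S avoiding a never needs e, so it is still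
-- an egg of S' = S|(G − e); hence a hitting set of S' plus a hits S.  An egg-cut
-- C of S' in G − e leaves the same graph as deleting C ∪ {e} from G, so C ∪ {e}
-- is an egg-cut of S.  Either way one extra element suffices.
module Submission where

open import Defs
open import Data.Nat using (ℕ; _≤_; _∸_; _+_; z≤n; s≤s)
open import Data.Nat.Properties using (≤-trans; ≤-reflexive; +-suc; +-monoʳ-≤; m≤n+o⇒m∸n≤o)
open import Data.Fin using (Fin)
open import Data.Fin.Subset using (Subset; _∈_; _∉_; _∪_; ⁅_⁆; ∣_∣; inside; outside)
open import Data.Fin.Subset.Properties
  using (∣p∣≤∣x∷p∣; ∣⁅x⁆∣≡1; x∈p∪q⁺; x∈p∪q⁻; x∈⁅x⁆; x∈⁅y⁆⇒x≡y; _∈?_)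
open import Data.Vec using ([]; _∷_)
open import Data.Product using (_,_; proj₁; proj₂; _×_)
open import Data.Sum using (inj₁; inj₂; [_,_])
open import Data.Unit using (tt)
open import Relation.Nullary using (yes; no)
open import Relation.Binary.PropositionalEquality using (_≢_; refl; subst; sym)

∣p∪q∣≤∣p∣+∣q∣ : ∀ {n} (p q : Subset n) → ∣ p ∪ q ∣ ≤ ∣ p ∣ + ∣ q ∣
∣p∪q∣≤∣p∣+∣q∣ []            []            = z≤n
∣p∪q∣≤∣p∣+∣q∣ (inside ∷ p)  (s ∷ q)       =
  s≤s (≤-trans (∣p∪q∣≤∣p∣+∣q∣ p q) (+-monoʳ-≤ ∣ p ∣ (∣p∣≤∣x∷p∣ s q)))
∣p∪q∣≤∣p∣+∣q∣ (outside ∷ p) (inside ∷ q)  =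
  ≤-trans (s≤s (∣p∪q∣≤∣p∣+∣q∣ p q)) (≤-reflexive (sym (+-suc ∣ p ∣ ∣ q ∣)))
∣p∪q∣≤∣p∣+∣q∣ (outside ∷ p) (outside ∷ q) = ∣p∪q∣≤∣p∣+∣q∣ p q

∣⁅x⁆∪p∣≤1+∣p∣ : ∀ {n} (x : Fin n) (p : Subset n) → ∣ ⁅ x ⁆ ∪ p ∣ ≤ 1 + ∣ p ∣
∣⁅x⁆∪p∣≤1+∣p∣ x p =
  subst (λ c → ∣ ⁅ x ⁆ ∪ p ∣ ≤ c + ∣ p ∣) (∣⁅x⁆∣≡1 x) (∣p∪q∣≤∣p∣+∣q∣ ⁅ x ⁆ p)

OrderAtLeast-∸1 : {G : Graph} {A B : EdgeSet G} {S : Scramble G A} {S′ : Scramble G B}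
  (k : ℕ) (x : Fin (n G)) (e : Fin (m G)) →
  (∀ T → Hits S′ T → Hits S (⁅ x ⁆ ∪ T)) →
  (∀ C → IsEggCut S′ C → IsEggCut S (⁅ e ⁆ ∪ C)) →
  OrderAtLeast S k → OrderAtLeast S′ (k ∸ 1)
OrderAtLeast-∸1 k x e hits⇒ cut⇒ (h≥k , e≥k) =
  (λ T hT → m≤n+o⇒m∸n≤o k 1 (≤-trans (h≥k _ (hits⇒ T hT)) (∣⁅x⁆∪p∣≤1+∣p∣ x T))) ,
  (λ C cC → m≤n+o⇒m∸n≤o k 1 (≤-trans (e≥k _ (cut⇒ C cC)) (∣⁅x⁆∪p∣≤1+∣p∣ e C)))

module _ {G : Graph} where

  -- Definitionally the edge set that IsEggCut uses for the graph after deleting C.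
  deleteEdges : EdgeSet G → Subset (m G) → EdgeSet G
  deleteEdges A C i = A i × i ∉ C

  Reach-end : ∀ {A W u v} → Reach G A W u v → v ∈ W
  Reach-end (here v∈W)         = v∈W
  Reach-end (step _ _ _ _ v∈W) = v∈W

  Reach-mono : ∀ {A B W u v} → (∀ i → A i → B i) → Reach G A W u v → Reach G B W u v
  Reach-mono A⊆B (here u∈W)         = here u∈W
  Reach-mono A⊆B (step i a j r y∈W) = step i (A⊆B i a) j (Reach-mono A⊆B r) y∈W

  InducesConnected-mono : ∀ {A B W} → (∀ i → A i → B i) →
    InducesConnected G A W → InducesConnected G B W
  InducesConnected-mono A⊆B conn u v u∈W v∈W = Reach-mono A⊆B (conn u v u∈W v∈W)

  Joins⇒proj₁∈ : ∀ {i x y} {W : Subset (n G)} →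
    Joins G i x y → x ∈ W → y ∈ W → proj₁ (ends G i) ∈ W
  Joins⇒proj₁∈ (inj₁ refl) x∈W y∈W = x∈W
  Joins⇒proj₁∈ (inj₂ refl) x∈W y∈W = y∈W

  Reach-deleteEdge : ∀ {A W u v} (e : Fin (m G)) → proj₁ (ends G e) ∉ W →
    Reach G A W u v → Reach G (deleteEdge G e) W u v
  Reach-deleteEdge e a∉W (here u∈W) = here u∈W
  Reach-deleteEdge e a∉W (step i _ j r y∈W) =
    step i i≢e j (Reach-deleteEdge e a∉W r) y∈W
    where
    i≢e : i ≢ e
    i≢e refl = a∉W (Joins⇒proj₁∈ j (Reach-end r) y∈W)

  InducesConnected-deleteEdge : ∀ {A W} (e : Fin (m G)) → proj₁ (ends G e) ∉ W →
    InducesConnected G A W → InducesConnected G (deleteEdge G e) W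
  InducesConnected-deleteEdge e a∉W conn u v u∈W v∈W =
    Reach-deleteEdge e a∉W (conn u v u∈W v∈W)

  Hits-restrict-deleteEdge : ∀ {A} (S : Scramble G A) (e : Fin (m G)) (T : Subset (n G)) →
    Hits (restrict S (deleteEdge G e)) T → Hits S (⁅ proj₁ (ends G e) ⁆ ∪ T)
  Hits-restrict-deleteEdge S e T hT E E∈S with proj₁ (ends G e) ∈? E
  ... | yes a∈E = proj₁ (ends G e) , a∈E , x∈p∪q⁺ (inj₁ (x∈⁅x⁆ _))
  ... | no  a∉E with hT E (E∈S , InducesConnected-deleteEdge e a∉E (proj₂ (isEgg S E E∈S)))
  ...   | v , v∈E , v∈T = v , v∈E , x∈p∪q⁺ (inj₂ v∈T)

  deleteEdges-deleteEdge⇒ : ∀ e C i →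
    deleteEdges (deleteEdge G e) C i → deleteEdges (allEdges G) (⁅ e ⁆ ∪ C) i
  deleteEdges-deleteEdge⇒ e C i (i≢e , i∉C) =
    tt , λ i∈ → [ (λ i∈e → i≢e (x∈⁅y⁆⇒x≡y e i∈e)) , i∉C ] (x∈p∪q⁻ ⁅ e ⁆ C i∈)

  deleteEdges-deleteEdge⇐ : ∀ e C i →
    deleteEdges (allEdges G) (⁅ e ⁆ ∪ C) i → deleteEdges (deleteEdge G e) C i
  deleteEdges-deleteEdge⇐ e C i (_ , i∉) =
    (λ { refl → i∉ (x∈p∪q⁺ (inj₁ (x∈⁅x⁆ i))) }) , λ i∈C → i∉ (x∈p∪q⁺ (inj₂ i∈C))

  IsEggCut-restrict-deleteEdge : (S : Scramble G (allEdges G)) (e : Fin (m G)) (C : Subset (m G)) →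
    IsEggCut (restrict S (deleteEdge G e)) C → IsEggCut S (⁅ e ⁆ ∪ C)
  IsEggCut-restrict-deleteEdge S e C
    (_ , X , X≠∅ , ∁X≠∅ , connX , conn∁X , noCross , (E₁ , (E₁∈S , _) , E₁⊆X) , (E₂ , (E₂∈S , _) , E₂⊆∁X)) =
    (λ _ _ → tt) , X , X≠∅ , ∁X≠∅ ,
    InducesConnected-mono (deleteEdges-deleteEdge⇒ e C) connX ,
    InducesConnected-mono (deleteEdges-deleteEdge⇒ e C) conn∁X ,
    (λ i x y i∈ → noCross i x y (deleteEdges-deleteEdge⇐ e C i i∈)) ,
    (E₁ , E₁∈S , E₁⊆X) , (E₂ , E₂∈S , E₂⊆∁X)

proposition3p2 : (G : Graph) (S : Scramble G (allEdges G)) (e : Fin (m G)) →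
    IsConnected G (deleteEdge G e) →
    (k : ℕ) → 2 ≤ k → OrderAtLeast S k →
    OrderAtLeast (restrict S (deleteEdge G e)) (k ∸ 1)
proposition3p2 G S e _ k _ =
  OrderAtLeast-∸1 {S = S} {S′ = restrict S (deleteEdge G e)} k (proj₁ (ends G e)) e
    (Hits-restrict-deleteEdge S e) (IsEggCut-restrict-deleteEdge S e)
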